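{- Let $q=2^m$ with $m$ a positive integer, let $a\in\mathbb{F}_q^*$ with $a\neq1$ and $\mathrm{Tr}(1/a)=\mathrm{Tr}(1)$, let $b\in\mathbb{F}_q$ satisfy $b^2+b+1=1/a$, let $\omega\in\mathbb{F}_4\setminus\mathbb{F}_2$, and put $c:=(b+\omega)/(b+\omega^2)$ and $n:=\lfloor(q+1)/3\rfloor$. Then $c$ is a cube in $\mathbb{F}_{q^2}$ if and only if $D_n(a)=0$.
   Context: $\mathrm{Tr}$ denotes the trace map from $\mathbb{F}_q$ to $\mathbb{F}_2$. For a positive integer $n$, $D_n(X)\in\mathbb{F}_2[X]$ is the Dickson polynomial of the first kind of degree $n$ with parameter $1$, i.e. the unique polynomial with $D_n(X+X^{ -1})=X^n+X^{ -n}$. All fields are viewed inside a fixed algebraic closure of $\mathbb{F}_2$. -}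

module Defs where

open import Level using (Level; _⊔_)
open import Data.Nat using (ℕ; zero; suc)
open import Data.Fin using (Fin)
open import Data.Product using (∃; Σ; _×_)
open import Relation.Binary.PropositionalEquality using (_≡_)
open import Relation.Nullary using (¬_)
open import Algebra.Bundles using (CommutativeRing)

module _ {c ℓ : Level} (R : CommutativeRing c ℓ) where
  open CommutativeRing R

  pow : Carrier → ℕ → Carrier
  pow x zero    = 1#
  pow x (suc n) = x * pow x n

  IsField : Set (c ⊔ ℓ)
  IsField = (¬ (1# ≈ 0#)) × (∀ x → ¬ (x ≈ 0#) → ∃ λ y → x * y ≈ 1#)

  HasCard : ℕ → Set (c ⊔ ℓ)
  HasCard k = Σ (Fin k → Carrier) λ e →
                (∀ x → ∃ λ i → e i ≈ x) × (∀ i j → e i ≈ e j → i ≡ j)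

  -- membership in the subfield F_{2^m} = { x | x^(2^m) = x }
  InSub : ℕ → Carrier → Set ℓ
  InSub m x = pow x (2 Data.Nat.^ m) ≈ x

  -- absolute trace F_{2^m} → F_2 (values viewed inside the ambient field):
  -- Tr(x) = Σ_{i<m} x^(2^i)
  Tr : ℕ → Carrier → Carrier
  Tr zero    x = 0#
  Tr (suc i) x = Tr i x + pow x (2 Data.Nat.^ i)

  -- Dickson polynomial of the first kind, parameter 1, evaluated at x:
  -- D_0 = 2, D_1 = X, D_{n+2} = X D_{n+1} - D_n
  dickson : ℕ → Carrier → Carrier
  dickson zero x = 1# + 1#
  dickson (suc zero) x = x
  dickson (suc (suc n)) x = x * dickson (suc n) x - dickson n x

{-# OPTIONS --safe #-}
-- With t = b + ω we have b + ω² = t + 1 and t(t + 1) = 1/a, so c = t/(t + 1) = t²a =: γ, while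
-- γ' = (t + 1)²a satisfies γγ' = 1 and γ + γ' = a. Hence D_n(a) = γⁿ + γ'ⁿ, which in characteristic 2
-- vanishes iff γⁿ = γ'ⁿ. Writing q² = 1 + 3N, a nonzero element is a cube iff its N-th power is 1:
-- cubes satisfy this by Fermat, and conversely the 3N units cube onto at least N elements (each fibre
-- has at most 3 points), all roots of X^N - 1. Finally the Frobenius x ↦ x^q fixes a and b and sends ω
-- to ω^(q mod 3), so γ^q = γ' if q ≡ 2 and γ^q = γ if q ≡ 1 (mod 3); with N = n(q - 1), resp.
-- N = n(q + 1), both cases give γ^N = 1 iff γⁿ = γ'ⁿ.
module Submission where

open import Defs
open import Level using (Level)
open import Data.Nat using (ℕ; zero; suc; _≤_; z≤n; s≤s; _/_) renaming (_+_ to _+ℕ_; _*_ to _*ℕ_; _^_ to _^ℕ_)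
open import Data.Product using (∃; _×_; _,_; proj₁; proj₂; map₂)
open import Data.Vec using (Vec; []; _∷_; replicate)
open import Data.List using (List; []; _∷_; length)
open import Data.List.Relation.Unary.All using (All; []; _∷_)
open import Data.List.Relation.Unary.AllPairs using (AllPairs; []; _∷_)
open import Relation.Nullary using (¬_)
open import Relation.Binary.PropositionalEquality as ≡ using (_≡_; _≢_)
open import Relation.Binary.Bundles using (Setoid)
open import Algebra.Bundles using (CommutativeRing; CommutativeMonoid; Monoid)
open import Function.Bundles using (_⇔_; mk⇔; Equivalence; Inverse)
open import Function.Properties.Equivalence using () renaming (trans to ⇔-trans; sym to ⇔-sym)
import Algebra.Properties.CommutativeMonoid.Sum

module _ {a ℓ : Level} (M : Monoid a ℓ) where
  open Monoid M

  translation : ∀ {u v} → u ∙ v ≈ ε → v ∙ u ≈ ε → Inverse setoid setoid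
  translation {u} {v} uv≈ε vu≈ε = record
    { to        = u ∙_
    ; from      = v ∙_
    ; to-cong   = ∙-congˡ
    ; from-cong = ∙-congˡ
    ; inverse   = (λ y≈vx → trans (∙-congˡ y≈vx) (cancel uv≈ε _))
                , (λ y≈ux → trans (∙-congˡ y≈ux) (cancel vu≈ε _))
    }
    where
    cancel : ∀ {u v} → u ∙ v ≈ ε → ∀ x → u ∙ (v ∙ x) ≈ x
    cancel {u} {v} uv≈ε x = trans (sym (assoc u v x)) (trans (∙-congʳ uv≈ε) (identityˡ x))

module Counting where
  open import Data.List using (filter)
  open import Data.List.Relation.Unary.All.Properties using (all-filter; filter⁺)
  import Data.List.Relation.Unary.AllPairs.Properties as AllPairs
  open import Relation.Unary using (Decidable)
  open import Relation.Unary.Properties using (∁?)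
  open import Relation.Nullary using (does; contradiction)
  open import Data.Bool using (true; false)
  open import Data.Nat.Properties using (+-suc; +-mono-≤; ≤-pred)
  open import Relation.Binary.Definitions using () renaming (Decidable to Decidable₂)
  import Data.List.Relation.Unary.All as All

  AtMost : ∀ {a ℓ p} (S : Setoid a ℓ) → (Setoid.Carrier S → Set p) → ℕ → Set _
  AtMost S P k = ∀ xs → AllPairs (Setoid._≉_ S) xs → All P xs → length xs ≤ k

  module _ {a ℓ} {S : Setoid a ℓ} where
    open Setoid S

    AtMost-⊆ : ∀ {p q} {P : Carrier → Set p} {R : Carrier → Set q} {k} →
               (∀ {x} → R x → P x) → AtMost S P k → AtMost S R k
    AtMost-⊆ R⊆P P≤k xs xs! Rxs = P≤k xs xs! (All.map R⊆P Rxs)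

    AtMost-remove : ∀ {p} {P : Carrier → Set p} {k y} →
                    AtMost S P (suc k) → P y → AtMost S (λ x → P x × x ≉ y) k
    AtMost-remove {y = y} P≤1+k Py xs xs! Pxs≉y =
      ≤-pred (P≤1+k (y ∷ xs) (All.map (λ x≉y y≈x → proj₂ x≉y (sym y≈x)) Pxs≉y ∷ xs!) (Py ∷ All.map proj₁ Pxs≉y))

  length-filter-∁ : ∀ {a p} {A : Set a} {P : A → Set p} (P? : Decidable P) xs →
                    length (filter P? xs) +ℕ length (filter (∁? P?) xs) ≡ length xs
  length-filter-∁ P? [] = ≡.refl
  length-filter-∁ P? (x ∷ xs) with does (P? x)
  ... | true  = ≡.cong suc (length-filter-∁ P? xs)
  ... | false = ≡.trans (+-suc _ _) (≡.cong suc (length-filter-∁ P? xs))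

  module _ {a₁ ℓ₁ a₂ ℓ₂} {S : Setoid a₁ ℓ₁} {T : Setoid a₂ ℓ₂}
           (_≟_ : Decidable₂ (Setoid._≈_ T)) (f : Setoid.Carrier S → Setoid.Carrier T) where
    private
      module S = Setoid S
      module T = Setoid T

    AtMost-preimage : ∀ {k} → (∀ y → AtMost S (λ x → f x T.≈ y) k) →
                      ∀ M {p} {P : T.Carrier → Set p} → AtMost T P M → AtMost S (λ x → P (f x)) (M *ℕ k)
    AtMost-preimage fibre≤k zero    P≤0 []      _ _ = z≤n
    AtMost-preimage fibre≤k zero    P≤0 (x ∷ _) _ (Pfx ∷ _) = contradiction (P≤0 (f x ∷ []) ([] ∷ []) (Pfx ∷ [])) λ ()
    AtMost-preimage fibre≤k (suc M) P≤1+M [] _ _ = z≤n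
    AtMost-preimage {k} fibre≤k (suc M) P≤1+M (x ∷ xs) (x∉xs ∷ xs!) (Pfx ∷ Pfxs) =
      ≡.subst (_≤ k +ℕ M *ℕ k) (length-filter-∁ fibre? (x ∷ xs))
        (+-mono-≤ (fibre≤k (f x) (filter fibre? (x ∷ xs)) (AllPairs.filter⁺ fibre? (x∉xs ∷ xs!)) (all-filter fibre? (x ∷ xs)))
                  (AtMost-preimage fibre≤k M (AtMost-remove {S = T} P≤1+M Pfx) (filter (∁? fibre?) (x ∷ xs))
                    (AllPairs.filter⁺ (∁? fibre?) (x∉xs ∷ xs!))
                    (All.zip (filter⁺ (∁? fibre?) (Pfx ∷ Pfxs) , all-filter (∁? fibre?) (x ∷ xs)))))
      where
      fibre? : Decidable (λ z → f z T.≈ f x)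
      fibre? z = f z ≟ f x

CharacteristicTwo : ∀ {c ℓ} → CommutativeRing c ℓ → Set ℓ
CharacteristicTwo L = 1# + 1# ≈ 0#
  where open CommutativeRing L

module CommRingLemmas {c ℓ : Level} (L : CommutativeRing c ℓ) where
  open CommutativeRing L
  open import Algebra.Properties.Semiring.Exp semiring public using (_^_; ^-congˡ; ^-homo-*; ^-assocʳ)
  open import Algebra.Properties.CommutativeSemiring.Exp commutativeSemiring public using (^-distrib-*)
  open import Algebra.Properties.Semiring.Mult semiring public using (×1-homo-*) renaming (_×_ to _·_)
  open import Algebra.Solver.Ring.NaturalCoefficients.Default commutativeSemiring
  open import Relation.Binary.Reasoning.Setoid setoid

  pow≡^ : ∀ x n → pow L x n ≡ x ^ n
  pow≡^ x zero    = ≡.refl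
  pow≡^ x (suc n) = ≡.cong (x *_) (pow≡^ x n)

  InSub⇒^≈ : ∀ m {x} → InSub L m x → x ^ (2 ^ℕ m) ≈ x
  InSub⇒^≈ m {x} xᵠ≈x = ≡.subst (_≈ x) (pow≡^ x (2 ^ℕ m)) xᵠ≈x

  ∃-^≈-cong : ∀ k {c c′} → c ≈ c′ → (∃ λ y → y ^ k ≈ c) ⇔ (∃ λ y → y ^ k ≈ c′)
  ∃-^≈-cong k c≈c′ = mk⇔ (map₂ (λ yᵏ≈c → trans yᵏ≈c c≈c′))
                         (map₂ (λ yᵏ≈c′ → trans yᵏ≈c′ (sym c≈c′)))

  ×1-homo-^ : ∀ a k → (a ^ℕ k) · 1# ≈ (a · 1#) ^ k
  ×1-homo-^ a zero    = +-identityʳ 1#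
  ×1-homo-^ a (suc k) = trans (×1-homo-* a (a ^ℕ k)) (*-congˡ (×1-homo-^ a k))

  1^≈1 : ∀ n → 1# ^ n ≈ 1#
  1^≈1 zero    = refl
  1^≈1 (suc n) = trans (*-identityˡ _) (1^≈1 n)

  ^-*-inverse : ∀ n {x y} → x * y ≈ 1# → x ^ n * y ^ n ≈ 1#
  ^-*-inverse n {x} {y} xy≈1 = trans (sym (^-distrib-* x y n)) (trans (^-congˡ n xy≈1) (1^≈1 n))

  dickson-cong : ∀ n {x y} → x ≈ y → dickson L n x ≈ dickson L n y
  dickson-cong zero          x≈y = refl
  dickson-cong (suc zero)    x≈y = x≈y
  dickson-cong (suc (suc n)) x≈y =
    +-cong (*-cong x≈y (dickson-cong (suc n) x≈y)) (-‿cong (dickson-cong n x≈y))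

  dickson-+-inverse : ∀ n {x y} → x * y ≈ 1# → dickson L n (x + y) ≈ x ^ n + y ^ n
  dickson-+-inverse zero          xy≈1 = refl
  dickson-+-inverse (suc zero)    xy≈1 = sym (+-cong (*-identityʳ _) (*-identityʳ _))
  dickson-+-inverse (suc (suc n)) {x} {y} xy≈1 = begin
    (x + y) * dickson L (suc n) (x + y) - dickson L n (x + y)
      ≈⟨ +-cong (*-congˡ (dickson-+-inverse (suc n) xy≈1)) (-‿cong (dickson-+-inverse n xy≈1)) ⟩
    (x + y) * (x ^ suc n + y ^ suc n) - (x ^ n + y ^ n)
      ≈⟨ +-congʳ expand ⟩
    (x ^ suc (suc n) + y ^ suc (suc n)) + (x ^ n + y ^ n) - (x ^ n + y ^ n)
      ≈⟨ +-assoc _ _ _ ⟩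
    (x ^ suc (suc n) + y ^ suc (suc n)) + ((x ^ n + y ^ n) - (x ^ n + y ^ n))
      ≈⟨ +-congˡ (-‿inverseʳ _) ⟩
    (x ^ suc (suc n) + y ^ suc (suc n)) + 0#
      ≈⟨ +-identityʳ _ ⟩
    x ^ suc (suc n) + y ^ suc (suc n) ∎
    where
    expand : (x + y) * (x ^ suc n + y ^ suc n) ≈ (x ^ suc (suc n) + y ^ suc (suc n)) + (x ^ n + y ^ n)
    expand = begin
      (x + y) * (x ^ suc n + y ^ suc n)
        ≈⟨ solve 4 (λ x y X Y → (x :+ y) :* (x :* X :+ y :* Y) := (x :* (x :* X) :+ y :* (y :* Y)) :+ (x :* y) :* (X :+ Y)) refl x y (x ^ n) (y ^ n) ⟩
      (x ^ suc (suc n) + y ^ suc (suc n)) + (x * y) * (x ^ n + y ^ n)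
        ≈⟨ +-congˡ (trans (*-congʳ xy≈1) (*-identityˡ _)) ⟩
      (x ^ suc (suc n) + y ^ suc (suc n)) + (x ^ n + y ^ n) ∎

module FieldLemmas {c ℓ : Level} (L : CommutativeRing c ℓ) (isField : IsField L) where
  open CommutativeRing L
  open CommRingLemmas L
  open Counting using (AtMost; AtMost-⊆)
  open import Algebra.Properties.Ring ring using (x∙y⁻¹≈ε⇒x≈y; x≈y⇒x∙y⁻¹≈ε; x[y-z]≈xy-xz; [y-z]x≈yx-zx)
  open import Algebra.Solver.Ring.NaturalCoefficients.Default commutativeSemiring
  open import Relation.Binary.Reasoning.Setoid setoid
  import Data.List.Relation.Unary.All as All
  open import Data.Empty using (⊥-elim)
  open import Data.Fin as Fin using (Fin)
  module Π = Algebra.Properties.CommutativeMonoid.Sum *-commutativeMonoid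

  1≉0 : ¬ 1# ≈ 0#
  1≉0 = proj₁ isField

  x*y≈0⇒y≈0 : ∀ {x y} → ¬ x ≈ 0# → x * y ≈ 0# → y ≈ 0#
  x*y≈0⇒y≈0 {x} {y} x≉0 xy≈0 with proj₂ isField x x≉0
  ... | x⁻¹ , xx⁻¹≈1 = begin
    y                ≈⟨ sym (*-identityˡ y) ⟩
    1# * y           ≈⟨ *-congʳ (sym xx⁻¹≈1) ⟩
    (x * x⁻¹) * y    ≈⟨ solve 3 (λ x x⁻¹ y → (x :* x⁻¹) :* y := x⁻¹ :* (x :* y)) refl x x⁻¹ y ⟩
    x⁻¹ * (x * y)    ≈⟨ *-congˡ xy≈0 ⟩
    x⁻¹ * 0#         ≈⟨ zeroʳ x⁻¹ ⟩
    0#               ∎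

  *-≉0 : ∀ {x y} → ¬ x ≈ 0# → ¬ y ≈ 0# → ¬ x * y ≈ 0#
  *-≉0 x≉0 y≉0 xy≈0 = y≉0 (x*y≈0⇒y≈0 x≉0 xy≈0)

  ^-≉0 : ∀ {x} n → ¬ x ≈ 0# → ¬ x ^ n ≈ 0#
  ^-≉0 zero    x≉0 = 1≉0
  ^-≉0 (suc n) x≉0 = *-≉0 x≉0 (^-≉0 n x≉0)

  *-cancelˡ : ∀ {x y z} → ¬ x ≈ 0# → x * y ≈ x * z → y ≈ z
  *-cancelˡ {x} {y} {z} x≉0 xy≈xz = x∙y⁻¹≈ε⇒x≈y y z (x*y≈0⇒y≈0 x≉0 (begin
    x * (y - z)      ≈⟨ x[y-z]≈xy-xz x y z ⟩
    x * y - x * z    ≈⟨ x≈y⇒x∙y⁻¹≈ε xy≈xz ⟩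
    0#               ∎))

  *≈1⇒≉0 : ∀ {x y} → x * y ≈ 1# → ¬ x ≈ 0#
  *≈1⇒≉0 {x} {y} xy≈1 x≈0 = 1≉0 (trans (sym xy≈1) (trans (*-congʳ x≈0) (zeroˡ y)))

  *≈⇒≈1⇔≈ : ∀ {x y z} → ¬ y ≈ 0# → x * y ≈ z → x ≈ 1# ⇔ y ≈ z
  *≈⇒≈1⇔≈ {x} {y} {z} y≉0 xy≈z = mk⇔
    (λ x≈1 → trans (sym (trans (*-congʳ x≈1) (*-identityˡ y))) xy≈z)
    (λ y≈z → *-cancelˡ y≉0 (trans (*-comm y x) (trans xy≈z (sym (trans (*-identityʳ y) y≈z)))))

  -- A monic polynomial of degree d is represented by its d lower coefficients, constant term first.
  eval : ∀ {d} → Vec Carrier d → Carrier → Carrier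
  eval []      x = 1#
  eval (a ∷ p) x = a + x * eval p x

  divide : ∀ {d} → Vec Carrier (suc d) → Carrier → Vec Carrier d
  divide (a ∷ [])    r = []
  divide (a ∷ b ∷ p) r = eval (b ∷ p) r ∷ divide (b ∷ p) r

  -- p(x) = (x - r)·d(x) + p(r) for d = divide p r, rearranged so that no subtraction occurs.
  eval-divide : ∀ {d} (p : Vec Carrier (suc d)) r x →
                eval p x + r * eval (divide p r) x ≈ x * eval (divide p r) x + eval p r
  eval-divide (a ∷ [])    r x = solve 3 (λ a r x → (a :+ x :* con 1) :+ r :* con 1 := x :* con 1 :+ (a :+ r :* con 1)) refl a r x
  eval-divide (a ∷ b ∷ p) r x = begin
    (a + x * P x) + r * (P r + x * D)
      ≈⟨ solve 6 (λ a r x Px Pr D → ((a :+ x :* Px) :+ r :* (Pr :+ x :* D)) := (a :+ r :* Pr) :+ x :* (Px :+ r :* D)) refl a r x (P x) (P r) D ⟩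
    (a + r * P r) + x * (P x + r * D)       ≈⟨ +-congˡ (*-congˡ (eval-divide (b ∷ p) r x)) ⟩
    (a + r * P r) + x * (x * D + P r)
      ≈⟨ solve 5 (λ a r x Pr D → (a :+ r :* Pr) :+ x :* (x :* D :+ Pr) := x :* (Pr :+ x :* D) :+ (a :+ r :* Pr)) refl a r x (P r) D ⟩
    x * (P r + x * D) + (a + r * P r)       ∎
    where
    P = eval (b ∷ p)
    D = eval (divide (b ∷ p) r) x

  divide-root : ∀ {d} (p : Vec Carrier (suc d)) {r s} → eval p r ≈ 0# → eval p s ≈ 0# → ¬ s ≈ r →
                eval (divide p r) s ≈ 0#
  divide-root p {r} {s} pr≈0 ps≈0 s≉r =
    x*y≈0⇒y≈0 (λ s-r≈0 → s≉r (x∙y⁻¹≈ε⇒x≈y s r s-r≈0)) (begin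
      (s - r) * D       ≈⟨ [y-z]x≈yx-zx D s r ⟩
      s * D - r * D     ≈⟨ x≈y⇒x∙y⁻¹≈ε sD≈rD ⟩
      0#                ∎)
    where
    D = eval (divide p r) s
    sD≈rD : s * D ≈ r * D
    sD≈rD = begin
      s * D             ≈⟨ sym (+-identityʳ _) ⟩
      s * D + 0#        ≈⟨ +-congˡ (sym pr≈0) ⟩
      s * D + eval p r  ≈⟨ sym (eval-divide p r s) ⟩
      eval p s + r * D  ≈⟨ +-congʳ ps≈0 ⟩
      0# + r * D        ≈⟨ +-identityˡ _ ⟩
      r * D             ∎

  roots-atMost : ∀ {d} (p : Vec Carrier d) → AtMost setoid (λ x → eval p x ≈ 0#) d
  roots-atMost []      []       _ _                = z≤n
  roots-atMost []      (r ∷ rs) _ (pr≈0 ∷ _)       = ⊥-elim (1≉0 pr≈0)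
  roots-atMost (a ∷ p) []       _ _                = z≤n
  roots-atMost (a ∷ p) (r ∷ rs) (r∉rs ∷ rs!) (pr≈0 ∷ prs≈0) =
    s≤s (roots-atMost (divide (a ∷ p) r) rs rs!
      (All.zipWith (λ (r≉s , ps≈0) → divide-root (a ∷ p) pr≈0 ps≈0 (λ s≈r → r≉s (sym s≈r))) (r∉rs , prs≈0)))

  ∏-≉0 : ∀ {k} (f : Fin k → Carrier) → (∀ i → ¬ f i ≈ 0#) → ¬ Π.sum f ≈ 0#
  ∏-≉0 {zero}  f fᵢ≉0 = 1≉0
  ∏-≉0 {suc k} f fᵢ≉0 = *-≉0 (fᵢ≉0 Fin.zero) (∏-≉0 (λ i → f (Fin.suc i)) (λ i → fᵢ≉0 (Fin.suc i)))

  eval-xᵏ : ∀ k x → eval (replicate k 0#) x ≈ x ^ k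
  eval-xᵏ zero    x = refl
  eval-xᵏ (suc k) x = trans (+-identityˡ _) (*-congˡ (eval-xᵏ k x))

  ^≈-atMost : ∀ k c → AtMost setoid (λ x → x ^ suc k ≈ c) (suc k)
  ^≈-atMost k c = AtMost-⊆ {S = setoid} root (roots-atMost (- c ∷ replicate k 0#))
    where
    root : ∀ {x} → x ^ suc k ≈ c → eval (- c ∷ replicate k 0#) x ≈ 0#
    root {x} xᵏ⁺¹≈c = begin
      - c + x * eval (replicate k 0#) x  ≈⟨ +-congˡ (*-congˡ (eval-xᵏ k x)) ⟩
      - c + x ^ suc k                    ≈⟨ +-congˡ xᵏ⁺¹≈c ⟩
      - c + c                            ≈⟨ -‿inverseˡ c ⟩
      0#                                 ∎

module CharTwo {c ℓ : Level} (L : CommutativeRing c ℓ) (1+1≈0 : CharacteristicTwo L) where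
  open CommutativeRing L
  open CommRingLemmas L
  open import Algebra.Solver.Ring.NaturalCoefficients.Default commutativeSemiring
  open import Relation.Binary.Reasoning.Setoid setoid

  x+x≈0 : ∀ x → x + x ≈ 0#
  x+x≈0 x = begin
    x + x          ≈⟨ solve 1 (λ x → x :+ x := (con 1 :+ con 1) :* x) refl x ⟩
    (1# + 1#) * x  ≈⟨ *-congʳ 1+1≈0 ⟩
    0# * x         ≈⟨ zeroˡ x ⟩
    0#             ∎

  x+y≈0⇔x≈y : ∀ {x y} → x + y ≈ 0# ⇔ x ≈ y
  x+y≈0⇔x≈y {x} {y} = mk⇔ to (λ x≈y → trans (+-congʳ x≈y) (x+x≈0 y))
    where
    to : x + y ≈ 0# → x ≈ y
    to x+y≈0 = begin
      x              ≈⟨ sym (+-identityʳ x) ⟩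
      x + 0#         ≈⟨ +-congˡ (sym (x+x≈0 y)) ⟩
      x + (y + y)    ≈⟨ sym (+-assoc x y y) ⟩
      (x + y) + y    ≈⟨ +-congʳ x+y≈0 ⟩
      0# + y         ≈⟨ +-identityˡ y ⟩
      y              ∎

  ^2-homo-+ : ∀ x y → (x + y) ^ 2 ≈ x ^ 2 + y ^ 2
  ^2-homo-+ x y = begin
    (x + y) ^ 2
      ≈⟨ solve 2 (λ x y → (x :+ y) :^ 2 := (x :^ 2 :+ y :^ 2) :+ (x :* y) :* (con 1 :+ con 1)) refl x y ⟩
    (x ^ 2 + y ^ 2) + (x * y) * (1# + 1#)  ≈⟨ +-congˡ (trans (*-congˡ 1+1≈0) (zeroʳ _)) ⟩
    (x ^ 2 + y ^ 2) + 0#         ≈⟨ +-identityʳ _ ⟩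
    x ^ 2 + y ^ 2 ∎

  frobenius-+ : ∀ k x y → (x + y) ^ (2 ^ℕ k) ≈ x ^ (2 ^ℕ k) + y ^ (2 ^ℕ k)
  frobenius-+ zero    x y = solve 2 (λ x y → (x :+ y) :* con 1 := x :* con 1 :+ y :* con 1) refl x y
  frobenius-+ (suc k) x y = begin
    (x + y) ^ (2 *ℕ 2 ^ℕ k)              ≈⟨ sym (^-assocʳ (x + y) 2 (2 ^ℕ k)) ⟩
    ((x + y) ^ 2) ^ (2 ^ℕ k)             ≈⟨ ^-congˡ (2 ^ℕ k) (^2-homo-+ x y) ⟩
    (x ^ 2 + y ^ 2) ^ (2 ^ℕ k)           ≈⟨ frobenius-+ k (x ^ 2) (y ^ 2) ⟩
    (x ^ 2) ^ (2 ^ℕ k) + (y ^ 2) ^ (2 ^ℕ k) ≈⟨ +-cong (^-assocʳ x 2 (2 ^ℕ k)) (^-assocʳ y 2 (2 ^ℕ k)) ⟩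
    x ^ (2 *ℕ 2 ^ℕ k) + y ^ (2 *ℕ 2 ^ℕ k) ∎

module FiniteField {c ℓ : Level} (L : CommutativeRing c ℓ) (isField : IsField L)
                   {n : ℕ} (card : HasCard L (suc n)) where
  open CommutativeRing L
  open CommRingLemmas L
  open FieldLemmas L isField
  open Counting
  open import Data.Fin as Fin using (Fin; punchIn; punchOut)
  open import Data.Fin.Properties using (¬Fin0; punchIn-injective; punchInᵢ≢i; punchIn-punchOut; any?)
  open import Data.Fin.Permutation using (Permutation; permutation)
  open import Data.List using (tabulate)
  open import Data.List.Properties using (length-tabulate)
  import Data.List.Relation.Unary.All.Properties as All
  import Data.List.Relation.Unary.AllPairs.Properties as AllPairs
  open import Relation.Nullary using (yes; no; contradiction)
  open import Relation.Nullary.Decidable using (map′; decidable-stable)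
  open import Relation.Binary.Definitions using (Decidable)
  open import Function.Base using (_∘_)
  open import Relation.Binary.Reasoning.Setoid setoid

  enum : Fin (suc n) → Carrier
  enum = proj₁ card

  index : Carrier → Fin (suc n)
  index x = proj₁ (proj₁ (proj₂ card) x)

  enum-index : ∀ x → enum (index x) ≈ x
  enum-index x = proj₂ (proj₁ (proj₂ card) x)

  enum-injective : ∀ {i j} → enum i ≈ enum j → i ≡ j
  enum-injective = proj₂ (proj₂ card) _ _

  index-injective : ∀ {x y} → index x ≡ index y → x ≈ y
  index-injective {x} {y} eq = trans (sym (enum-index x)) (trans (reflexive (≡.cong enum eq)) (enum-index y))

  infix 4 _≟_
  _≟_ : Decidable _≈_
  x ≟ y = map′ index-injective
               (λ x≈y → enum-injective (trans (enum-index x) (trans x≈y (sym (enum-index y)))))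
               (index x Fin.≟ index y)

  unit : Fin n → Carrier
  unit k = enum (punchIn (index 0#) k)

  unit-≉0 : ∀ k → ¬ unit k ≈ 0#
  unit-≉0 k uₖ≈0 = punchInᵢ≢i (index 0#) k (enum-injective (trans uₖ≈0 (sym (enum-index 0#))))

  unit-surjective : ∀ {x} → ¬ x ≈ 0# → ∃ λ k → unit k ≈ x
  unit-surjective {x} x≉0 = punchOut 0≢x , trans (reflexive (≡.cong enum (punchIn-punchOut 0≢x))) (enum-index x)
    where
    0≢x : index 0# ≢ index x
    0≢x eq = x≉0 (sym (index-injective eq))

  module _ {c' ℓ'} (M : CommutativeMonoid c' ℓ') where
    private module M = CommutativeMonoid M
    open import Algebra.Properties.CommutativeMonoid.Sum M using (sum; sum-permute; sum-cong-≋)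

    sum-invariant : (G : Carrier → M.Carrier) → (∀ {x y} → x ≈ y → G x M.≈ G y) →
                    (φ : Inverse setoid setoid) → sum (G ∘ enum) M.≈ sum (G ∘ Inverse.to φ ∘ enum)
    sum-invariant G G-cong φ = M.trans (sum-permute (G ∘ enum) π) (sum-cong-≋ (λ i → G-cong (enum-index (to (enum i)))))
      where
      open Inverse φ
      π : Permutation (suc n) (suc n)
      π = permutation (λ i → index (to (enum i))) (λ i → index (from (enum i)))
        (λ i → enum-injective (trans (enum-index _) (trans (to-cong (enum-index _)) (strictlyInverseˡ (enum i)))))
        (λ i → enum-injective (trans (enum-index _) (trans (from-cong (enum-index _)) (strictlyInverseʳ (enum i)))))

  module Σ = Algebra.Properties.CommutativeMonoid.Sum +-commutativeMonoid

  -- Translation by 1 permutes the field, so Σ x = Σ (1 + x) = (1 + n)·1 + Σ x.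
  card·1≈0 : suc n · 1# ≈ 0#
  card·1≈0 = +-identityˡ-unique (suc n · 1#) (Σ.sum enum) (begin
    suc n · 1# + Σ.sum enum          ≈⟨ +-congʳ (sym (Σ.sum-replicate (suc n))) ⟩
    Σ.sum {suc n} (λ _ → 1#) + Σ.sum enum    ≈⟨ sym (Σ.∑-distrib-+ (λ _ → 1#) enum) ⟩
    Σ.sum (λ i → 1# + enum i)        ≈⟨ sym (sum-invariant +-commutativeMonoid (λ x → x) (λ x≈y → x≈y)
                                              (translation +-monoid (-‿inverseʳ 1#) (-‿inverseˡ 1#))) ⟩
    Σ.sum enum                       ∎)
    where open import Algebra.Properties.Ring ring using (+-identityˡ-unique)

  ^≈0⇒≈0 : ∀ {x} k → x ^ k ≈ 0# → x ≈ 0#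
  ^≈0⇒≈0 {x} k xᵏ≈0 = decidable-stable (x ≟ 0#) (λ x≉0 → ^-≉0 k x≉0 xᵏ≈0)

  char-two : ∀ m → suc n ≡ 4 ^ℕ m → CharacteristicTwo L
  char-two m 1+n≡4ᵐ = ^≈0⇒≈0 2 (begin
    (1# + 1#) ^ 2  ≈⟨ solve 1 (λ x → (con 1 :+ con 1) :^ 2 := con 1 :+ (con 1 :+ (con 1 :+ (con 1 :+ con 0)))) refl 1# ⟩
    4 · 1#         ≈⟨ ^≈0⇒≈0 m (begin
      (4 · 1#) ^ m     ≈⟨ sym (×1-homo-^ 4 m) ⟩
      (4 ^ℕ m) · 1#    ≡⟨ ≡.cong (_· 1#) (≡.sym 1+n≡4ᵐ) ⟩
      suc n · 1#       ≈⟨ card·1≈0 ⟩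
      0#               ∎) ⟩
    0#             ∎)
    where open import Algebra.Solver.Ring.NaturalCoefficients.Default commutativeSemiring

  unitPart : Carrier → Carrier
  unitPart x with x ≟ 0#
  ... | yes _ = 1#
  ... | no  _ = x

  unitPart-cong : ∀ {x y} → x ≈ y → unitPart x ≈ unitPart y
  unitPart-cong {x} {y} x≈y with x ≟ 0# | y ≟ 0#
  ... | yes _   | yes _   = refl
  ... | yes x≈0 | no  y≉0 = contradiction (trans (sym x≈y) x≈0) y≉0
  ... | no  x≉0 | yes y≈0 = contradiction (trans x≈y y≈0) x≉0
  ... | no  _   | no  _   = x≈y

  unitPart-0 : ∀ {x} → x ≈ 0# → unitPart x ≈ 1#
  unitPart-0 {x} x≈0 with x ≟ 0#
  ... | yes _   = refl
  ... | no  x≉0 = contradiction x≈0 x≉0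

  unitPart-unit : ∀ {x} → ¬ x ≈ 0# → unitPart x ≈ x
  unitPart-unit {x} x≉0 with x ≟ 0#
  ... | yes x≈0 = contradiction x≈0 x≉0
  ... | no  _   = refl

  ∏-enum≈∏-unit : (G : Carrier → Carrier) → (∀ {x y} → x ≈ y → G x ≈ G y) → G 0# ≈ 1# →
               Π.sum (G ∘ enum) ≈ Π.sum (G ∘ unit)
  ∏-enum≈∏-unit G G-cong G0≈1 = begin
    Π.sum (G ∘ enum)                         ≈⟨ Π.sum-remove {i = index 0#} (G ∘ enum) ⟩
    G (enum (index 0#)) * Π.sum (G ∘ unit)   ≈⟨ *-congʳ (trans (G-cong (enum-index 0#)) G0≈1) ⟩
    1# * Π.sum (G ∘ unit)                    ≈⟨ *-identityˡ _ ⟩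
    Π.sum (G ∘ unit)                         ∎

  -- Multiplication by y permutes the field; comparing the products of the nonzero elements before
  -- and after gives yⁿ = 1.
  fermat : ∀ {y} → ¬ y ≈ 0# → y ^ n ≈ 1#
  fermat {y} y≉0 with proj₂ isField y y≉0
  ... | y⁻¹ , yy⁻¹≈1 = *-cancelˡ (∏-≉0 unit unit-≉0) (trans (*-comm _ _) (trans shift (sym (*-identityʳ _))))
    where
    shift : y ^ n * Π.sum unit ≈ Π.sum unit
    shift = begin
      y ^ n * Π.sum unit                 ≈⟨ *-congʳ (sym (Π.sum-replicate n)) ⟩
      Π.sum {n} (λ _ → y) * Π.sum unit       ≈⟨ sym (Π.∑-distrib-+ (λ _ → y) unit) ⟩
      Π.sum (λ k → y * unit k)           ≈⟨ sym (Π.sum-cong-≋ (λ k → unitPart-unit (*-≉0 y≉0 (unit-≉0 k)))) ⟩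
      Π.sum (unitPart ∘ (y *_) ∘ unit)   ≈⟨ sym (∏-enum≈∏-unit (unitPart ∘ (y *_)) (unitPart-cong ∘ *-congˡ) (unitPart-0 (zeroʳ y))) ⟩
      Π.sum (unitPart ∘ (y *_) ∘ enum)   ≈⟨ sym (sum-invariant *-commutativeMonoid unitPart unitPart-cong
                                               (translation *-monoid yy⁻¹≈1 (trans (*-comm y⁻¹ y) yy⁻¹≈1))) ⟩
      Π.sum (unitPart ∘ enum)            ≈⟨ ∏-enum≈∏-unit unitPart unitPart-cong (unitPart-0 refl) ⟩
      Π.sum (unitPart ∘ unit)            ≈⟨ Π.sum-cong-≋ (λ k → unitPart-unit (unit-≉0 k)) ⟩
      Π.sum unit                         ∎

  -- If c were not a cube, cubing would map the 3N units into the at most N - 1 roots of X^N - 1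
  -- other than c, with fibres of at most 3 points.
  ¬¬-cube-root : ∀ N → n ≡ 3 *ℕ N → ∀ {c} → c ^ N ≈ 1# → ¬ (∀ y → ¬ y ^ 3 ≈ c)
  ¬¬-cube-root zero    n≡0 _ _ = ¬Fin0 (≡.subst Fin n≡0 (proj₁ (unit-surjective 1≉0)))
  ¬¬-cube-root (suc M) n≡3N {c} cᴺ≈1 noCubeRoot = m+1+n≰m (M *ℕ 3) (≡.subst (_≤ M *ℕ 3) length-units bound)
    where
    open import Data.Nat.Properties using (m+1+n≰m)
    import Data.Nat.Properties as ℕ
    cube-is-root : ∀ k → (unit k ^ 3) ^ suc M ≈ 1#
    cube-is-root k = trans (^-assocʳ (unit k) 3 (suc M)) (trans (reflexive (≡.cong (unit k ^_) (≡.sym n≡3N))) (fermat (unit-≉0 k)))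
    bound : length (tabulate unit) ≤ M *ℕ 3
    bound = AtMost-preimage {S = setoid} {T = setoid} _≟_ (_^ 3) (^≈-atMost 2) M (AtMost-remove {S = setoid} (^≈-atMost M 1#) cᴺ≈1)
              (tabulate unit)
              (AllPairs.tabulate⁺ (λ k≢l uₖ≈uₗ → k≢l (punchIn-injective (index 0#) _ _ (enum-injective uₖ≈uₗ))))
              (All.tabulate⁺ (λ k → cube-is-root k , noCubeRoot (unit k)))
    length-units : length (tabulate unit) ≡ M *ℕ 3 +ℕ 3
    length-units = ≡.trans (length-tabulate unit) (≡.trans n≡3N (≡.trans (ℕ.*-comm 3 (suc M)) (ℕ.+-comm 3 (M *ℕ 3))))

  cube-criterion : ∀ N → n ≡ 3 *ℕ N → ∀ {c} → ¬ c ≈ 0# → (∃ λ y → y ^ 3 ≈ c) ⇔ c ^ N ≈ 1#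
  cube-criterion N n≡3N {c} c≉0 = mk⇔ cube⇒ ⇒cube
    where
    cube⇒ : (∃ λ y → y ^ 3 ≈ c) → c ^ N ≈ 1#
    cube⇒ (y , y³≈c) = begin
      c ^ N          ≈⟨ ^-congˡ N (sym y³≈c) ⟩
      (y ^ 3) ^ N    ≈⟨ ^-assocʳ y 3 N ⟩
      y ^ (3 *ℕ N)   ≡⟨ ≡.cong (y ^_) (≡.sym n≡3N) ⟩
      y ^ n          ≈⟨ fermat (λ y≈0 → c≉0 (trans (sym y³≈c) (trans (^-congˡ 3 y≈0) (zeroˡ _)))) ⟩
      1#             ∎
    ⇒cube : c ^ N ≈ 1# → ∃ λ y → y ^ 3 ≈ c
    ⇒cube cᴺ≈1 with any? (λ i → enum i ^ 3 ≟ c)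
    ... | yes (i , eᵢ³≈c) = enum i , eᵢ³≈c
    ... | no  noCubeRoot  = contradiction (λ y y³≈c → noCubeRoot (index y , trans (^-congˡ 3 (enum-index y)) y³≈c))
                                          (¬¬-cube-root N n≡3N cᴺ≈1)

module PowersOfTwo where
  open import Data.Nat.DivMod using (m/n≡1+[m∸n]/n; m*n/n≡m)
  open import Data.Nat.Properties using (*-cancelˡ-≡; suc-injective)
  open import Data.Nat.Solver using (module +-*-Solver)
  open +-*-Solver
  open import Data.Sum using (_⊎_; inj₁; inj₂)
  open ≡.≡-Reasoning

  2^-mod-3 : ∀ m → ∃ λ k → (2 ^ℕ m ≡ 2 +ℕ k *ℕ 3) ⊎ (2 ^ℕ m ≡ 1 +ℕ k *ℕ 3)
  2^-mod-3 zero = 0 , inj₂ ≡.refl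
  2^-mod-3 (suc m) with 2^-mod-3 m
  ... | k , inj₁ 2ᵐ≡2+3k = 1 +ℕ 2 *ℕ k , inj₂ (≡.trans (≡.cong (2 *ℕ_) 2ᵐ≡2+3k)
          (solve 1 (λ k → con 2 :* (con 2 :+ k :* con 3) := con 1 :+ (con 1 :+ con 2 :* k) :* con 3) ≡.refl k))
  ... | k , inj₂ 2ᵐ≡1+3k = 2 *ℕ k , inj₁ (≡.trans (≡.cong (2 *ℕ_) 2ᵐ≡1+3k)
          (solve 1 (λ k → con 2 :* (con 1 :+ k :* con 3) := con 2 :+ (con 2 :* k) :* con 3) ≡.refl k))

  4^≡1+3N : ∀ m → ∃ λ N → 4 ^ℕ m ≡ suc (3 *ℕ N)
  4^≡1+3N zero = 0 , ≡.refl
  4^≡1+3N (suc m) with 4^≡1+3N m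
  ... | N , 4ᵐ≡1+3N = 1 +ℕ 4 *ℕ N , ≡.trans (≡.cong (4 *ℕ_) 4ᵐ≡1+3N)
          (solve 1 (λ N → con 4 :* (con 1 :+ con 3 :* N) := con 1 :+ con 3 :* (con 1 :+ con 4 :* N)) ≡.refl N)

  4^≡2^*2^ : ∀ m → 4 ^ℕ m ≡ 2 ^ℕ m *ℕ 2 ^ℕ m
  4^≡2^*2^ zero    = ≡.refl
  4^≡2^*2^ (suc m) = ≡.trans (≡.cong (4 *ℕ_) (4^≡2^*2^ m))
    (solve 1 (λ x → con 4 :* (x :* x) := (con 2 :* x) :* (con 2 :* x)) ≡.refl (2 ^ℕ m))

  [2+k*3]/3≡k : ∀ k → (2 +ℕ k *ℕ 3) / 3 ≡ k
  [2+k*3]/3≡k zero    = ≡.refl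
  [2+k*3]/3≡k (suc k) = ≡.trans (m/n≡1+[m∸n]/n {2 +ℕ suc k *ℕ 3} {3} (s≤s (s≤s (s≤s z≤n)))) (≡.cong suc ([2+k*3]/3≡k k))

  exponents-2-mod-3 : ∀ m k N → 2 ^ℕ m ≡ 2 +ℕ k *ℕ 3 → 4 ^ℕ m ≡ suc (3 *ℕ N) →
                      (2 ^ℕ m +ℕ 1) / 3 ≡ suc k × N +ℕ suc k ≡ 2 ^ℕ m *ℕ suc k
  exponents-2-mod-3 m k N 2ᵐ≡2+3k 4ᵐ≡1+3N = n≡1+k , (begin
      N +ℕ suc k                         ≡⟨ ≡.cong (_+ℕ suc k) N≡ ⟩
      suc k *ℕ (1 +ℕ k *ℕ 3) +ℕ suc k
        ≡⟨ solve 1 (λ k → (con 1 :+ k) :* (con 1 :+ k :* con 3) :+ (con 1 :+ k) := (con 2 :+ k :* con 3) :* (con 1 :+ k)) ≡.refl k ⟩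
      (2 +ℕ k *ℕ 3) *ℕ suc k              ≡⟨ ≡.cong (_*ℕ suc k) (≡.sym 2ᵐ≡2+3k) ⟩
      2 ^ℕ m *ℕ suc k                    ∎)
    where
    n≡1+k : (2 ^ℕ m +ℕ 1) / 3 ≡ suc k
    n≡1+k = ≡.trans (≡.cong (λ q → (q +ℕ 1) / 3) 2ᵐ≡2+3k)
              (≡.trans (≡.cong (_/ 3) (solve 1 (λ k → (con 2 :+ k :* con 3) :+ con 1 := (con 1 :+ k) :* con 3) ≡.refl k)) (m*n/n≡m (suc k) 3))
    N≡ : N ≡ suc k *ℕ (1 +ℕ k *ℕ 3)
    N≡ = *-cancelˡ-≡ N _ 3 (suc-injective (begin
      suc (3 *ℕ N)                          ≡⟨ ≡.sym 4ᵐ≡1+3N ⟩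
      4 ^ℕ m                                ≡⟨ 4^≡2^*2^ m ⟩
      2 ^ℕ m *ℕ 2 ^ℕ m                      ≡⟨ ≡.cong₂ _*ℕ_ 2ᵐ≡2+3k 2ᵐ≡2+3k ⟩
      (2 +ℕ k *ℕ 3) *ℕ (2 +ℕ k *ℕ 3)
        ≡⟨ solve 1 (λ k → (con 2 :+ k :* con 3) :* (con 2 :+ k :* con 3) := con 1 :+ con 3 :* ((con 1 :+ k) :* (con 1 :+ k :* con 3))) ≡.refl k ⟩
      suc (3 *ℕ (suc k *ℕ (1 +ℕ k *ℕ 3)))   ∎))

  exponents-1-mod-3 : ∀ m k N → 2 ^ℕ m ≡ 1 +ℕ k *ℕ 3 → 4 ^ℕ m ≡ suc (3 *ℕ N) →
                      (2 ^ℕ m +ℕ 1) / 3 ≡ k × N ≡ 2 ^ℕ m *ℕ k +ℕ k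
  exponents-1-mod-3 m k N 2ᵐ≡1+3k 4ᵐ≡1+3N = n≡k , (begin
      N                                  ≡⟨ N≡ ⟩
      k *ℕ (2 +ℕ k *ℕ 3)
        ≡⟨ solve 1 (λ k → k :* (con 2 :+ k :* con 3) := (con 1 :+ k :* con 3) :* k :+ k) ≡.refl k ⟩
      (1 +ℕ k *ℕ 3) *ℕ k +ℕ k            ≡⟨ ≡.cong (λ q → q *ℕ k +ℕ k) (≡.sym 2ᵐ≡1+3k) ⟩
      2 ^ℕ m *ℕ k +ℕ k                   ∎)
    where
    n≡k : (2 ^ℕ m +ℕ 1) / 3 ≡ k
    n≡k = ≡.trans (≡.cong (λ q → (q +ℕ 1) / 3) 2ᵐ≡1+3k)
            (≡.trans (≡.cong (_/ 3) (solve 1 (λ k → (con 1 :+ k :* con 3) :+ con 1 := con 2 :+ k :* con 3) ≡.refl k)) ([2+k*3]/3≡k k))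
    N≡ : N ≡ k *ℕ (2 +ℕ k *ℕ 3)
    N≡ = *-cancelˡ-≡ N _ 3 (suc-injective (begin
      suc (3 *ℕ N)                          ≡⟨ ≡.sym 4ᵐ≡1+3N ⟩
      4 ^ℕ m                                ≡⟨ 4^≡2^*2^ m ⟩
      2 ^ℕ m *ℕ 2 ^ℕ m                      ≡⟨ ≡.cong₂ _*ℕ_ 2ᵐ≡1+3k 2ᵐ≡1+3k ⟩
      (1 +ℕ k *ℕ 3) *ℕ (1 +ℕ k *ℕ 3)
        ≡⟨ solve 1 (λ k → (con 1 :+ k :* con 3) :* (con 1 :+ k :* con 3) := con 1 :+ con 3 :* (k :* (con 2 :+ k :* con 3))) ≡.refl k ⟩
      suc (3 *ℕ (k *ℕ (2 +ℕ k *ℕ 3)))       ∎))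

module CubicSetting {c ℓ : Level} (L : CommutativeRing c ℓ) (isField : IsField L) (1+1≈0 : CharacteristicTwo L) where
  open CommutativeRing L
  open CharTwo L 1+1≈0
  open CommRingLemmas L
  open FieldLemmas L isField using (x*y≈0⇒y≈0; *-cancelˡ; *≈⇒≈1⇔≈; ^-≉0; *≈1⇒≉0)
  open PowersOfTwo
  open import Data.Sum using (inj₁; inj₂)
  open import Algebra.Solver.Ring.NaturalCoefficients.Default commutativeSemiring
  open import Relation.Binary.Reasoning.Setoid setoid
  import Data.Nat.Properties as ℕ

  primitive-cube-root : ∀ {ω} → ω ^ 4 ≈ ω → ¬ ω ≈ 0# → ¬ ω ≈ 1# → ω * ω ≈ ω + 1#
  primitive-cube-root {ω} ω⁴≈ω ω≉0 ω≉1 =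
    Equivalence.to x+y≈0⇔x≈y (trans (sym (+-assoc _ _ _)) (x*y≈0⇒y≈0 ω+1≉0 (begin
      (ω + 1#) * (ω * ω + ω + 1#)
        ≈⟨ solve 1 (λ ω → (ω :+ con 1) :* (ω :* ω :+ ω :+ con 1) := (ω :^ 3 :+ con 1) :+ (ω :* ω :+ ω) :* (con 1 :+ con 1)) refl ω ⟩
      (ω ^ 3 + 1#) + (ω * ω + ω) * (1# + 1#)    ≈⟨ +-cong (+-congʳ ω³≈1) (trans (*-congˡ 1+1≈0) (zeroʳ _)) ⟩
      (1# + 1#) + 0#                            ≈⟨ +-identityʳ _ ⟩
      1# + 1#                                   ≈⟨ 1+1≈0 ⟩
      0#                                        ∎)))
    where
    ω³≈1 : ω ^ 3 ≈ 1#
    ω³≈1 = *-cancelˡ ω≉0 (trans ω⁴≈ω (sym (*-identityʳ ω)))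
    ω+1≉0 : ¬ ω + 1# ≈ 0#
    ω+1≉0 ω+1≈0 = ω≉1 (Equivalence.to x+y≈0⇔x≈y ω+1≈0)

  module Conjugates {a ainv : Carrier} (a*ainv≈1 : a * ainv ≈ 1#)
                    {b : Carrier} (b²+b+1≈ainv : b * b + b + 1# ≈ ainv)
                    {ω : Carrier} (ω²≈ω+1 : ω * ω ≈ ω + 1#) where

    t γ γ' : Carrier
    t  = b + ω
    γ  = t * t * a
    γ' = (t + 1#) * (t + 1#) * a

    t*[t+1]≈ainv : t * (t + 1#) ≈ ainv
    t*[t+1]≈ainv = begin
      (b + ω) * ((b + ω) + 1#)
        ≈⟨ solve 2 (λ b ω → (b :+ ω) :* ((b :+ ω) :+ con 1) := (b :* b :+ b :+ (ω :* ω :+ ω)) :+ (b :* ω) :* (con 1 :+ con 1)) refl b ω ⟩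
      (b * b + b + (ω * ω + ω)) + (b * ω) * (1# + 1#)   ≈⟨ +-cong (+-congˡ (trans (+-congʳ ω²≈ω+1) ω+1+ω≈1)) (trans (*-congˡ 1+1≈0) (zeroʳ _)) ⟩
      (b * b + b + 1#) + 0#                             ≈⟨ +-identityʳ _ ⟩
      b * b + b + 1#                                    ≈⟨ b²+b+1≈ainv ⟩
      ainv                                              ∎
      where
      ω+1+ω≈1 : (ω + 1#) + ω ≈ 1#
      ω+1+ω≈1 = trans (solve 1 (λ ω → (ω :+ con 1) :+ ω := con 1 :+ (ω :+ ω)) refl ω) (trans (+-congˡ (x+x≈0 ω)) (+-identityʳ 1#))

    γ*γ'≈1 : γ * γ' ≈ 1#
    γ*γ'≈1 = begin
      (t * t * a) * ((t + 1#) * (t + 1#) * a)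
        ≈⟨ solve 2 (λ t a → (t :* t :* a) :* ((t :+ con 1) :* (t :+ con 1) :* a) := (t :* (t :+ con 1) :* a) :* (t :* (t :+ con 1) :* a)) refl t a ⟩
      (t * (t + 1#) * a) * (t * (t + 1#) * a)          ≈⟨ *-cong ainv*a≈1 ainv*a≈1 ⟩
      1# * 1#                                          ≈⟨ *-identityʳ 1# ⟩
      1#                                               ∎
      where
      ainv*a≈1 : t * (t + 1#) * a ≈ 1#
      ainv*a≈1 = trans (*-congʳ t*[t+1]≈ainv) (trans (*-comm ainv a) a*ainv≈1)

    γ+γ'≈a : γ + γ' ≈ a
    γ+γ'≈a = begin
      t * t * a + (t + 1#) * (t + 1#) * a
        ≈⟨ solve 2 (λ t a → t :* t :* a :+ (t :+ con 1) :* (t :+ con 1) :* a := a :+ (t :* t :* a :+ t :* a) :* (con 1 :+ con 1)) refl t a ⟩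
      a + (t * t * a + t * a) * (1# + 1#)              ≈⟨ +-congˡ (trans (*-congˡ 1+1≈0) (zeroʳ _)) ⟩
      a + 0#                                           ≈⟨ +-identityʳ a ⟩
      a                                                ∎

    quotient≈γ : ∀ {d} → (b + ω * ω) * d ≈ 1# → (b + ω) * d ≈ γ
    quotient≈γ {d} [b+ω²]d≈1 = begin
      t * d                                  ≈⟨ *-congˡ d≈ta ⟩
      t * (t * a)                            ≈⟨ sym (*-assoc t t a) ⟩
      γ                                      ∎
      where
      b+ω²≈t+1 : b + ω * ω ≈ t + 1#
      b+ω²≈t+1 = trans (+-congˡ ω²≈ω+1) (sym (+-assoc b ω 1#))
      s*ta≈1 : (b + ω * ω) * (t * a) ≈ 1#
      s*ta≈1 = begin
        (b + ω * ω) * (t * a)                ≈⟨ *-congʳ b+ω²≈t+1 ⟩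
        (t + 1#) * (t * a)
          ≈⟨ solve 2 (λ t a → (t :+ con 1) :* (t :* a) := t :* (t :+ con 1) :* a) refl t a ⟩
        t * (t + 1#) * a                     ≈⟨ *-congʳ t*[t+1]≈ainv ⟩
        ainv * a                             ≈⟨ trans (*-comm ainv a) a*ainv≈1 ⟩
        1#                                   ∎
      d≈ta : d ≈ t * a
      d≈ta = begin
        d                                    ≈⟨ sym (*-identityˡ d) ⟩
        1# * d                               ≈⟨ *-congʳ (sym s*ta≈1) ⟩
        ((b + ω * ω) * (t * a)) * d
          ≈⟨ solve 3 (λ s x d → (s :* x) :* d := (s :* d) :* x) refl (b + ω * ω) (t * a) d ⟩
        ((b + ω * ω) * d) * (t * a)          ≈⟨ *-congʳ [b+ω²]d≈1 ⟩
        1# * (t * a)                         ≈⟨ *-identityˡ _ ⟩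
        t * a                                ∎

    γ≉0 : ¬ γ ≈ 0#
    γ≉0 = *≈1⇒≉0 γ*γ'≈1

    γ'≉0 : ¬ γ' ≈ 0#
    γ'≉0 = *≈1⇒≉0 (trans (*-comm γ' γ) γ*γ'≈1)

    dickson≈0⇔ : ∀ n → dickson L n a ≈ 0# ⇔ γ ^ n ≈ γ' ^ n
    dickson≈0⇔ n = mk⇔ (λ Dₙ≈0 → Equivalence.to x+y≈0⇔x≈y (trans (sym Dₙ≈γⁿ+γ'ⁿ) Dₙ≈0))
                       (λ γⁿ≈γ'ⁿ → trans Dₙ≈γⁿ+γ'ⁿ (Equivalence.from x+y≈0⇔x≈y γⁿ≈γ'ⁿ))
      where
      Dₙ≈γⁿ+γ'ⁿ : dickson L n a ≈ γ ^ n + γ' ^ n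
      Dₙ≈γⁿ+γ'ⁿ = trans (dickson-cong n (sym γ+γ'≈a)) (dickson-+-inverse n γ*γ'≈1)

    ω³≈1 : ω ^ 3 ≈ 1#
    ω³≈1 = begin
      ω * (ω * (ω * 1#))   ≈⟨ solve 1 (λ ω → ω :* (ω :* (ω :* con 1)) := ω :* (ω :* ω)) refl ω ⟩
      ω * (ω * ω)          ≈⟨ *-congˡ ω²≈ω+1 ⟩
      ω * (ω + 1#)         ≈⟨ solve 1 (λ ω → ω :* (ω :+ con 1) := ω :* ω :+ ω) refl ω ⟩
      ω * ω + ω            ≈⟨ +-congʳ ω²≈ω+1 ⟩
      (ω + 1#) + ω         ≈⟨ solve 1 (λ ω → (ω :+ con 1) :+ ω := con 1 :+ (ω :+ ω)) refl ω ⟩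
      1# + (ω + ω)         ≈⟨ +-congˡ (x+x≈0 ω) ⟩
      1# + 0#              ≈⟨ +-identityʳ 1# ⟩
      1#                   ∎

    ω^[r+3k]≈ω^r : ∀ r k → ω ^ (r +ℕ k *ℕ 3) ≈ ω ^ r
    ω^[r+3k]≈ω^r r k = begin
      ω ^ (r +ℕ k *ℕ 3)      ≈⟨ ^-homo-* ω r (k *ℕ 3) ⟩
      ω ^ r * ω ^ (k *ℕ 3)   ≡⟨ ≡.cong (λ e → ω ^ r * ω ^ e) (ℕ.*-comm k 3) ⟩
      ω ^ r * ω ^ (3 *ℕ k)   ≈⟨ *-congˡ (sym (^-assocʳ ω 3 k)) ⟩
      ω ^ r * (ω ^ 3) ^ k    ≈⟨ *-congˡ (trans (^-congˡ k ω³≈1) (1^≈1 k)) ⟩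
      ω ^ r * 1#             ≈⟨ *-identityʳ _ ⟩
      ω ^ r                  ∎

    γ^2^m : ∀ m → b ^ (2 ^ℕ m) ≈ b → a ^ (2 ^ℕ m) ≈ a →
            γ ^ (2 ^ℕ m) ≈ (b + ω ^ (2 ^ℕ m)) * (b + ω ^ (2 ^ℕ m)) * a
    γ^2^m m bᵠ≈b aᵠ≈a = begin
      ((t * t) * a) ^ q           ≈⟨ ^-distrib-* (t * t) a q ⟩
      (t * t) ^ q * a ^ q         ≈⟨ *-cong (^-distrib-* t t q) aᵠ≈a ⟩
      (t ^ q * t ^ q) * a         ≈⟨ *-congʳ (*-cong tᵠ≈b+ωᵠ tᵠ≈b+ωᵠ) ⟩
      (b + ω ^ q) * (b + ω ^ q) * a ∎
      where
      q = 2 ^ℕ m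
      tᵠ≈b+ωᵠ : t ^ q ≈ b + ω ^ q
      tᵠ≈b+ωᵠ = trans (frobenius-+ m b ω) (+-congʳ bᵠ≈b)

    frobenius-2-mod-3 : ∀ m k → 2 ^ℕ m ≡ 2 +ℕ k *ℕ 3 → b ^ (2 ^ℕ m) ≈ b → a ^ (2 ^ℕ m) ≈ a →
                        γ ^ (2 ^ℕ m) ≈ γ'
    frobenius-2-mod-3 m k q≡2+3k bᵠ≈b aᵠ≈a =
      trans (γ^2^m m bᵠ≈b aᵠ≈a) (*-congʳ (*-cong b+ωᵠ≈t+1 b+ωᵠ≈t+1))
      where
      b+ωᵠ≈t+1 : b + ω ^ (2 ^ℕ m) ≈ t + 1#
      b+ωᵠ≈t+1 = begin
        b + ω ^ (2 ^ℕ m)          ≡⟨ ≡.cong (λ e → b + ω ^ e) q≡2+3k ⟩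
        b + ω ^ (2 +ℕ k *ℕ 3)     ≈⟨ +-congˡ (ω^[r+3k]≈ω^r 2 k) ⟩
        b + ω * (ω * 1#)          ≈⟨ +-congˡ (trans (*-congˡ (*-identityʳ ω)) ω²≈ω+1) ⟩
        b + (ω + 1#)              ≈⟨ sym (+-assoc b ω 1#) ⟩
        t + 1#                    ∎

    frobenius-1-mod-3 : ∀ m k → 2 ^ℕ m ≡ 1 +ℕ k *ℕ 3 → b ^ (2 ^ℕ m) ≈ b → a ^ (2 ^ℕ m) ≈ a →
                        γ ^ (2 ^ℕ m) ≈ γ
    frobenius-1-mod-3 m k q≡1+3k bᵠ≈b aᵠ≈a =
      trans (γ^2^m m bᵠ≈b aᵠ≈a) (*-congʳ (*-cong b+ωᵠ≈t b+ωᵠ≈t))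
      where
      b+ωᵠ≈t : b + ω ^ (2 ^ℕ m) ≈ t
      b+ωᵠ≈t = begin
        b + ω ^ (2 ^ℕ m)          ≡⟨ ≡.cong (λ e → b + ω ^ e) q≡1+3k ⟩
        b + ω ^ (1 +ℕ k *ℕ 3)     ≈⟨ +-congˡ (ω^[r+3k]≈ω^r 1 k) ⟩
        b + ω * 1#                ≈⟨ +-congˡ (*-identityʳ ω) ⟩
        t                         ∎

    frobenius-criterion : ∀ m N → b ^ (2 ^ℕ m) ≈ b → a ^ (2 ^ℕ m) ≈ a → 4 ^ℕ m ≡ suc (3 *ℕ N) →
                          let n = (2 ^ℕ m +ℕ 1) / 3 in γ ^ N ≈ 1# ⇔ γ ^ n ≈ γ' ^ n
    frobenius-criterion m N bᵠ≈b aᵠ≈a 4ᵐ≡1+3N with 2^-mod-3 m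
    ... | k , inj₁ q≡2+3k with exponents-2-mod-3 m k N q≡2+3k 4ᵐ≡1+3N
    ...   | n≡1+k , N+n≡qn =
      ≡.subst (λ n → γ ^ N ≈ 1# ⇔ γ ^ n ≈ γ' ^ n) (≡.sym n≡1+k) (*≈⇒≈1⇔≈ (^-≉0 (suc k) γ≉0) (begin
        γ ^ N * γ ^ suc k         ≈⟨ sym (^-homo-* γ N (suc k)) ⟩
        γ ^ (N +ℕ suc k)          ≡⟨ ≡.cong (γ ^_) N+n≡qn ⟩
        γ ^ (2 ^ℕ m *ℕ suc k)     ≈⟨ sym (^-assocʳ γ (2 ^ℕ m) (suc k)) ⟩
        (γ ^ 2 ^ℕ m) ^ suc k      ≈⟨ ^-congˡ (suc k) (frobenius-2-mod-3 m k q≡2+3k bᵠ≈b aᵠ≈a) ⟩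
        γ' ^ suc k                ∎))
    frobenius-criterion m N bᵠ≈b aᵠ≈a 4ᵐ≡1+3N
        | k , inj₂ q≡1+3k with exponents-1-mod-3 m k N q≡1+3k 4ᵐ≡1+3N
    ...   | n≡k , N≡qn+n =
      ≡.subst (λ n → γ ^ N ≈ 1# ⇔ γ ^ n ≈ γ' ^ n) (≡.sym n≡k) (⇔-trans (*≈⇒≈1⇔≈ (^-≉0 k γ'≉0) (begin
        γ ^ N * γ' ^ k                         ≡⟨ ≡.cong (λ e → γ ^ e * γ' ^ k) N≡qn+n ⟩
        γ ^ (2 ^ℕ m *ℕ k +ℕ k) * γ' ^ k        ≈⟨ *-congʳ (^-homo-* γ (2 ^ℕ m *ℕ k) k) ⟩
        (γ ^ (2 ^ℕ m *ℕ k) * γ ^ k) * γ' ^ k   ≈⟨ *-congʳ (*-congʳ (sym (^-assocʳ γ (2 ^ℕ m) k))) ⟩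
        ((γ ^ 2 ^ℕ m) ^ k * γ ^ k) * γ' ^ k    ≈⟨ *-congʳ (*-congʳ (^-congˡ k (frobenius-1-mod-3 m k q≡1+3k bᵠ≈b aᵠ≈a))) ⟩
        (γ ^ k * γ ^ k) * γ' ^ k               ≈⟨ *-assoc _ _ _ ⟩
        γ ^ k * (γ ^ k * γ' ^ k)               ≈⟨ *-congˡ (^-*-inverse k γ*γ'≈1) ⟩
        γ ^ k * 1#                             ≈⟨ *-identityʳ _ ⟩
        γ ^ k                                  ∎)) (mk⇔ sym sym))

open import Data.Nat using (_^_)

lemma5p4 : {c ℓ : Level} (m : ℕ) → 1 ≤ m →
    (L : CommutativeRing c ℓ) → IsField L → HasCard L (4 ^ m) →
    let open CommutativeRing L in
    (a : Carrier) → InSub L m a → ¬ (a ≈ 0#) → ¬ (a ≈ 1#) →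
    (ainv : Carrier) → a * ainv ≈ 1# →
    Tr L m ainv ≈ Tr L m 1# →
    (b : Carrier) → InSub L m b → b * b + b + 1# ≈ ainv →
    (ω : Carrier) → InSub L 2 ω → ¬ (ω ≈ 0#) → ¬ (ω ≈ 1#) →
    (d : Carrier) → (b + ω * ω) * d ≈ 1# →
    ((∃ λ y → pow L y 3 ≈ (b + ω) * d) ⇔ (dickson L ((2 ^ m +ℕ 1) / 3) a ≈ 0#))
lemma5p4 m _ L isField card a aᵠ≈a _ _ ainv a*ainv≈1 _ b bᵠ≈b b²+b+1≈ainv ω ω⁴≈ω ω≉0 ω≉1 d [b+ω²]d≈1
  with PowersOfTwo.4^≡1+3N m
... | N , 4ᵐ≡1+3N =
  ⇔-trans (∃-^≈-cong 3 (quotient≈γ [b+ω²]d≈1))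
  (⇔-trans (cube-criterion N ≡.refl γ≉0)
  (⇔-trans (frobenius-criterion m N (InSub⇒^≈ m bᵠ≈b) (InSub⇒^≈ m aᵠ≈a) 4ᵐ≡1+3N)
           (⇔-sym (dickson≈0⇔ ((2 ^ m +ℕ 1) / 3)))))
  where
  open CommRingLemmas L using (∃-^≈-cong; InSub⇒^≈)
  open FiniteField L isField (≡.subst (HasCard L) 4ᵐ≡1+3N card)
  open CubicSetting L isField (char-two m (≡.sym 4ᵐ≡1+3N))
  open Conjugates a*ainv≈1 b²+b+1≈ainv (primitive-cube-root ω⁴≈ω ω≉0 ω≉1)
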